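{- Let $\mathbf A$ be an sp-orthomodular lattice and $x,y\in\mathrm{Sh}(\mathbf A)$. Then the subalgebra $\mathbf{Sg}(x,y)$ of $\mathbf A$ generated by $\{x,y\}$ is distributive if and only if $x$ and $y$ commute in $\mathbf{Sh}(\mathbf A)$. In particular, in that case $\mathbf{Sg}(x,y)$ is a Boolean subalgebra of $\mathbf A$.
   Context: A pseudo-Kleene lattice is a bounded lattice with antitone involution ${}'$ satisfying $x\land x'\leq y\lor y'$; it is sp-orthomodular if for all $x,y$: (SP1) $x\leq y$ and $x'\land y=(x\land x')\lor(y\land y')$ imply $y\land(x\lor x')=x\lor(y\land y')$; (SP2) $x\leq y$ implies $(x\land x')\lor(y\land y')=(x'\land y)\land(x'\land y)'$. $\mathrm{Sh}(\mathbf A)=\{x: x\land x'=0\}$, and $\mathbf{Sh}(\mathbf A)=(\mathrm{Sh}(\mathbf A),\leq,{}',0,1)$ with inherited order and involution. Elements $x,y$ commute in $\mathbf{Sh}(\mathbf A)$ if the infima of $\{x,y\}$ and $\{x,y'\}$ exist in the poset $\mathrm{Sh}(\mathbf A)$ and $x$ is the supremum in $\mathrm{Sh}(\mathbf A)$ of these two infima. A Boolean subalgebra is a distributive subalgebra all of whose elements $z$ satisfy $z\land z'=0$. -}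

module Defs where

open import Level using (Level; _⊔_; suc)
open import Data.Product using (Σ; _×_; _,_)
open import Algebra.Lattice.Bundles using (Lattice)

record PseudoKleeneLattice c ℓ : Set (suc (c ⊔ ℓ)) where
  field
    lattice : Lattice c ℓ

  open Lattice lattice public

  infix 4 _≤_
  _≤_ : Carrier → Carrier → Set ℓ
  x ≤ y = x ∧ y ≈ x

  infix 8 _′
  field
    𝟎 𝟏      : Carrier
    _′       : Carrier → Carrier
    ∧-zero   : ∀ x → x ∧ 𝟎 ≈ 𝟎
    ∨-one    : ∀ x → x ∨ 𝟏 ≈ 𝟏
    ′-cong   : ∀ {x y} → x ≈ y → x ′ ≈ y ′
    ′-invol  : ∀ x → (x ′) ′ ≈ x
    ′-antitone : ∀ {x y} → x ≤ y → y ′ ≤ x ′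
    kleene   : ∀ x y → x ∧ x ′ ≤ y ∨ y ′

record SpOrthomodularLattice c ℓ : Set (suc (c ⊔ ℓ)) where
  field
    pkl : PseudoKleeneLattice c ℓ

  open PseudoKleeneLattice pkl public

  field
    SP1 : ∀ x y → x ≤ y → x ′ ∧ y ≈ (x ∧ x ′) ∨ (y ∧ y ′) →
          y ∧ (x ∨ x ′) ≈ x ∨ (y ∧ y ′)
    SP2 : ∀ x y → x ≤ y →
          (x ∧ x ′) ∨ (y ∧ y ′) ≈ (x ′ ∧ y) ∧ (x ′ ∧ y) ′

module PKLNotions {c ℓ} (A : PseudoKleeneLattice c ℓ) where
  open PseudoKleeneLattice A

  Sh : Carrier → Set ℓ
  Sh x = x ∧ x ′ ≈ 𝟎

  IsInfSh : Carrier → Carrier → Carrier → Set (c ⊔ ℓ)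
  IsInfSh a b m = Sh m × m ≤ a × m ≤ b ×
    (∀ w → Sh w → w ≤ a → w ≤ b → w ≤ m)

  IsSupSh : Carrier → Carrier → Carrier → Set (c ⊔ ℓ)
  IsSupSh a b s = Sh s × a ≤ s × b ≤ s ×
    (∀ w → Sh w → a ≤ w → b ≤ w → s ≤ w)

  Commute : Carrier → Carrier → Set (c ⊔ ℓ)
  Commute x y = Σ Carrier λ m₁ → Σ Carrier λ m₂ →
    IsInfSh x y m₁ × IsInfSh x (y ′) m₂ × IsSupSh m₁ m₂ x

  data Sg (x y : Carrier) : Carrier → Set (c ⊔ ℓ) where
    gen₁ : Sg x y x
    gen₂ : Sg x y y
    zer  : Sg x y 𝟎
    one  : Sg x y 𝟏
    join : ∀ {a b} → Sg x y a → Sg x y b → Sg x y (a ∨ b)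
    meet : ∀ {a b} → Sg x y a → Sg x y b → Sg x y (a ∧ b)
    inv  : ∀ {a} → Sg x y a → Sg x y (a ′)

  Distributive : (Carrier → Set (c ⊔ ℓ)) → Set (c ⊔ ℓ)
  Distributive S = ∀ a b d → S a → S b → S d →
    a ∧ (b ∨ d) ≈ (a ∧ b) ∨ (a ∧ d)

  BooleanSub : (Carrier → Set (c ⊔ ℓ)) → Set (c ⊔ ℓ)
  BooleanSub S = Distributive S × (∀ z → S z → Sh z)

{-# OPTIONS --safe #-}

-- If Sg(x, y) is distributive, then x ∧ y and x ∧ y′ are sharp, hence they
-- are the infima of {x, y} and {x, y′} in Sh(A), and x = (x ∧ y) ∨ (x ∧ y′).
-- Conversely, let a and b be these infima with x = a ⊔ b in Sh(A).  By (SP2)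
-- joins of orthogonal sharp elements and relative complements u′ ∧ w of sharp
-- u ≤ w are sharp, and by (SP1) sharp u ≤ w with u′ ∧ w = 0 are equal.  Hence
-- a, b, a′ ∧ y, b′ ∧ y′ are pairwise orthogonal sharp elements with join 1,
-- and the joins of their subfamilies form a copy of the Boolean algebra 2⁴
-- in A.  It contains x = a ∨ b and y = a ∨ (a′ ∧ y), hence all of Sg(x, y).
module Submission where

open import Algebra.Bundles using (CommutativeBand)
open import Data.Bool using (Bool; true; false; not)
  renaming (_∨_ to _∨ᵇ_; _∧_ to _∧ᵇ_)
import Data.Bool.Properties as Boolₚ
import Algebra.Lattice.Properties.BooleanAlgebra Boolₚ.∨-∧-booleanAlgebra as BoolAlg
open import Data.Nat using (ℕ)
open import Data.Product using (Σ; _×_; _,_; proj₁)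
open import Data.Vec using (Vec; []; _∷_; map; zipWith; replicate)
open import Data.Vec.Relation.Unary.All as All using (All; []; _∷_)
open import Data.Vec.Relation.Unary.AllPairs using (AllPairs; []; _∷_)
open import Function using (_∘_)
open import Function.Bundles using (_⇔_; mk⇔)
open import Relation.Binary.PropositionalEquality as ≡ using (_≡_; cong₂)
open import Defs

private
  variable
    n : ℕ

zipWith-∨-inverseˡ : (s : Vec Bool n) → zipWith _∨ᵇ_ (map not s) s ≡ replicate n true
zipWith-∨-inverseˡ []      = ≡.refl
zipWith-∨-inverseˡ (p ∷ s) = cong₂ _∷_ (Boolₚ.∨-inverseˡ p) (zipWith-∨-inverseˡ s)

not-∨-not : ∀ p q → not (not p ∨ᵇ not q) ≡ p ∧ᵇ q
not-∨-not p q = ≡.trans (BoolAlg.deMorgan₂ (not p) (not q))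
                        (cong₂ _∧ᵇ_ (Boolₚ.not-involutive p) (Boolₚ.not-involutive q))

map-not-zipWith-∨-not : (s t : Vec Bool n) →
  map not (zipWith _∨ᵇ_ (map not s) (map not t)) ≡ zipWith _∧ᵇ_ s t
map-not-zipWith-∨-not []      []      = ≡.refl
map-not-zipWith-∨-not (p ∷ s) (q ∷ t) = cong₂ _∷_ (not-∨-not p q) (map-not-zipWith-∨-not s t)

zipWith-∧-distribˡ-∨ : (s t r : Vec Bool n) →
  zipWith _∧ᵇ_ s (zipWith _∨ᵇ_ t r) ≡ zipWith _∨ᵇ_ (zipWith _∧ᵇ_ s t) (zipWith _∧ᵇ_ s r)
zipWith-∧-distribˡ-∨ []      []      []      = ≡.refl
zipWith-∧-distribˡ-∨ (p ∷ s) (q ∷ t) (r ∷ u) =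
  cong₂ _∷_ (Boolₚ.∧-distribˡ-∨ p q r) (zipWith-∧-distribˡ-∨ s t u)

module PseudoKleeneProperties {ℓ₁ ℓ} (A : PseudoKleeneLattice ℓ₁ ℓ) where
  open PseudoKleeneLattice A
  open PKLNotions A
  open import Algebra.Lattice.Properties.Lattice lattice
    using (∧-idem; ∨-idem; ∨-isSemilattice; ∨-∧-orderTheoreticLattice)
  import Relation.Binary.Lattice as Order
  open import Relation.Binary.Reasoning.Setoid setoid

  private
    ∨-commutativeBand : CommutativeBand ℓ₁ ℓ
    ∨-commutativeBand = record { isCommutativeBand = ∨-isSemilattice }

  open import Algebra.Properties.CommutativeSemigroup
    (CommutativeBand.commutativeSemigroup ∨-commutativeBand)
    using () renaming (interchange to ∨-interchange)

  -- The library orders a lattice by u ≈ u ∧ v, the symmetric form of _≤_.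
  private
    module O = Order.Lattice ∨-∧-orderTheoreticLattice
    variable
      u v w : Carrier

  ≤-refl : u ≤ u
  ≤-refl = ∧-idem _

  ≤-reflexive : u ≈ v → u ≤ v
  ≤-reflexive e = sym (O.reflexive e)

  ≤-trans : u ≤ v → v ≤ w → u ≤ w
  ≤-trans p q = sym (O.trans (sym p) (sym q))

  ≤-antisym : u ≤ v → v ≤ u → u ≈ v
  ≤-antisym p q = O.antisym (sym p) (sym q)

  ≤-respˡ-≈ : u ≈ v → u ≤ w → v ≤ w
  ≤-respˡ-≈ e p = ≤-trans (≤-reflexive (sym e)) p

  ≤-respʳ-≈ : v ≈ w → u ≤ v → u ≤ w
  ≤-respʳ-≈ e p = ≤-trans p (≤-reflexive e)

  x∧y≤x : ∀ u v → u ∧ v ≤ u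
  x∧y≤x u v = sym (O.x∧y≤x u v)

  x∧y≤y : ∀ u v → u ∧ v ≤ v
  x∧y≤y u v = sym (O.x∧y≤y u v)

  ∧-greatest : u ≤ v → u ≤ w → u ≤ v ∧ w
  ∧-greatest p q = sym (O.∧-greatest (sym p) (sym q))

  x≤x∨y : ∀ u v → u ≤ u ∨ v
  x≤x∨y u v = sym (O.x≤x∨y u v)

  y≤x∨y : ∀ u v → v ≤ u ∨ v
  y≤x∨y u v = sym (O.y≤x∨y u v)

  ∨-least : u ≤ w → v ≤ w → u ∨ v ≤ w
  ∨-least p q = sym (O.∨-least (sym p) (sym q))

  x≤y⇒x∨y≈y : u ≤ v → u ∨ v ≈ v
  x≤y⇒x∨y≈y p = ≤-antisym (∨-least p ≤-refl) (y≤x∨y _ _)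

  𝟎≤ : ∀ u → 𝟎 ≤ u
  𝟎≤ u = trans (∧-comm 𝟎 u) (∧-zero u)

  ≤𝟏 : ∀ u → u ≤ 𝟏
  ≤𝟏 u = trans (∧-congˡ (sym (∨-one u))) (∧-absorbs-∨ u 𝟏)

  ∨-identityˡ : ∀ u → 𝟎 ∨ u ≈ u
  ∨-identityˡ u = x≤y⇒x∨y≈y (𝟎≤ u)

  ∨-identityʳ : ∀ u → u ∨ 𝟎 ≈ u
  ∨-identityʳ u = trans (∨-comm u 𝟎) (∨-identityˡ u)

  ′-flip : u ≤ v ′ → v ≤ u ′
  ′-flip {v = v} p = ≤-respˡ-≈ (′-invol v) (′-antitone p)

  deMorgan₂ : ∀ u v → (u ∨ v) ′ ≈ u ′ ∧ v ′
  deMorgan₂ u v = ≤-antisym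
    (∧-greatest (′-antitone (x≤x∨y u v)) (′-antitone (y≤x∨y u v)))
    (′-flip (∨-least (′-flip (x∧y≤x (u ′) (v ′))) (′-flip (x∧y≤y (u ′) (v ′)))))

  deMorgan₁ : ∀ u v → (u ∧ v) ′ ≈ u ′ ∨ v ′
  deMorgan₁ u v = begin
    (u ∧ v) ′             ≈⟨ ′-cong (∧-cong (′-invol u) (′-invol v)) ⟨
    (u ′ ′ ∧ v ′ ′) ′     ≈⟨ ′-cong (deMorgan₂ (u ′) (v ′)) ⟨
    (u ′ ∨ v ′) ′ ′       ≈⟨ ′-invol _ ⟩
    u ′ ∨ v ′             ∎

  𝟎′≈𝟏 : 𝟎 ′ ≈ 𝟏
  𝟎′≈𝟏 = ≤-antisym (≤𝟏 _) (′-flip (𝟎≤ _))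

  𝟏′≈𝟎 : 𝟏 ′ ≈ 𝟎
  𝟏′≈𝟎 = trans (′-cong (sym 𝟎′≈𝟏)) (′-invol 𝟎)

  infix 4 _⊥_
  _⊥_ : Carrier → Carrier → Set ℓ
  u ⊥ v = u ≤ v ′

  ⊥-sym : u ⊥ v → v ⊥ u
  ⊥-sym = ′-flip

  ⊥-∨ʳ : u ⊥ v → u ⊥ w → u ⊥ v ∨ w
  ⊥-∨ʳ p q = ≤-respʳ-≈ (sym (deMorgan₂ _ _)) (∧-greatest p q)

  ⊥-𝟎 : ∀ u → u ⊥ 𝟎
  ⊥-𝟎 u = ≤-respʳ-≈ (sym 𝟎′≈𝟏) (≤𝟏 u)

  ≤-⊥ : u ≤ w → v ≤ w ′ → u ⊥ v
  ≤-⊥ u≤w v≤w′ = ≤-trans u≤w (′-flip v≤w′)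

  Sh-cong : u ≈ v → Sh u → Sh v
  Sh-cong e h = trans (∧-cong (sym e) (′-cong (sym e))) h

  Sh-′ : Sh u → Sh (u ′)
  Sh-′ {u} h = trans (∧-congˡ (′-invol u)) (trans (∧-comm (u ′) u) h)

  Sh-𝟎 : Sh 𝟎
  Sh-𝟎 = 𝟎≤ (𝟎 ′)

  Sh⇒x∨x′≈𝟏 : Sh u → u ∨ u ′ ≈ 𝟏
  Sh⇒x∨x′≈𝟏 {u} h = begin
    u ∨ u ′         ≈⟨ ∨-comm u (u ′) ⟩
    u ′ ∨ u         ≈⟨ ∨-congˡ (′-invol u) ⟨
    u ′ ∨ u ′ ′     ≈⟨ deMorgan₁ u (u ′) ⟨
    (u ∧ u ′) ′     ≈⟨ ′-cong h ⟩
    𝟎 ′             ≈⟨ 𝟎′≈𝟏 ⟩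
    𝟏               ∎

  Sh-∧ : Sh u → Sh v →
         (u ∧ v) ∧ (u ′ ∨ v ′) ≈ ((u ∧ v) ∧ u ′) ∨ ((u ∧ v) ∧ v ′) → Sh (u ∧ v)
  Sh-∧ {u} {v} hu hv distrib = begin
    (u ∧ v) ∧ (u ∧ v) ′                  ≈⟨ ∧-congˡ (deMorgan₁ u v) ⟩
    (u ∧ v) ∧ (u ′ ∨ v ′)                ≈⟨ distrib ⟩
    ((u ∧ v) ∧ u ′) ∨ ((u ∧ v) ∧ v ′)    ≈⟨ ∨-cong u∧v∧u′≈𝟎 u∧v∧v′≈𝟎 ⟩
    𝟎 ∨ 𝟎                                ≈⟨ ∨-idem 𝟎 ⟩
    𝟎                                    ∎
    where
    u∧v∧u′≈𝟎 : (u ∧ v) ∧ u ′ ≈ 𝟎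
    u∧v∧u′≈𝟎 = begin
      (u ∧ v) ∧ u ′   ≈⟨ ∧-congʳ (∧-comm u v) ⟩
      (v ∧ u) ∧ u ′   ≈⟨ ∧-assoc v u (u ′) ⟩
      v ∧ (u ∧ u ′)   ≈⟨ ∧-congˡ hu ⟩
      v ∧ 𝟎           ≈⟨ ∧-zero v ⟩
      𝟎               ∎
    u∧v∧v′≈𝟎 : (u ∧ v) ∧ v ′ ≈ 𝟎
    u∧v∧v′≈𝟎 = trans (∧-assoc u v (v ′)) (trans (∧-congˡ hv) (∧-zero u))

  meet-IsInfSh : Sh (u ∧ v) → IsInfSh u v (u ∧ v)
  meet-IsInfSh h = h , x∧y≤x _ _ , x∧y≤y _ _ , λ _ _ → ∧-greatest

  join-IsSupSh : Sh w → u ∨ v ≈ w → IsSupSh u v w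
  join-IsSupSh h e =
    h , ≤-respʳ-≈ e (x≤x∨y _ _) , ≤-respʳ-≈ e (y≤x∨y _ _) ,
    λ _ _ p q → ≤-respˡ-≈ e (∨-least p q)

  distributive⇒commute : ∀ {x y} → Sh x → Sh y → Distributive (Sg x y) → Commute x y
  distributive⇒commute {x} {y} hx hy distrib =
    x ∧ y , x ∧ y ′ ,
    meet-IsInfSh (Sh-∧ hx hy
      (distrib _ _ _ (meet gen₁ gen₂) (inv gen₁) (inv gen₂))) ,
    meet-IsInfSh (Sh-∧ hx (Sh-′ hy)
      (distrib _ _ _ (meet gen₁ (inv gen₂)) (inv gen₁) (inv (inv gen₂)))) ,
    join-IsSupSh hx x∧y∨x∧y′≈x
    where
    x∧y∨x∧y′≈x : (x ∧ y) ∨ (x ∧ y ′) ≈ x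
    x∧y∨x∧y′≈x = begin
      (x ∧ y) ∨ (x ∧ y ′)   ≈⟨ distrib x y (y ′) gen₁ gen₂ (inv gen₂) ⟨
      x ∧ (y ∨ y ′)         ≈⟨ ∧-congˡ (Sh⇒x∨x′≈𝟏 hy) ⟩
      x ∧ 𝟏                 ≈⟨ ≤𝟏 x ⟩
      x                     ∎

  pick : Bool → Carrier → Carrier
  pick true  e = e
  pick false e = 𝟎

  pick-∨ : ∀ p q e → pick p e ∨ pick q e ≈ pick (p ∨ᵇ q) e
  pick-∨ true  true  e = ∨-idem e
  pick-∨ true  false e = ∨-identityʳ e
  pick-∨ false q     e = ∨-identityˡ (pick q e)

  ⊥-pick : ∀ p → u ⊥ w → u ⊥ pick p w
  ⊥-pick true  o = o
  ⊥-pick false o = ⊥-𝟎 _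

  pick-⊥ : ∀ p → w ⊥ u → pick p w ⊥ u
  pick-⊥ p = ⊥-sym ∘ ⊥-pick p ∘ ⊥-sym

  pick-not-⊥ : ∀ p e → pick (not p) e ⊥ pick p e
  pick-not-⊥ true  e = 𝟎≤ _
  pick-not-⊥ false e = ⊥-𝟎 e

  Sh-pick : ∀ p → Sh w → Sh (pick p w)
  Sh-pick true  h = h
  Sh-pick false h = Sh-𝟎

  infix 9 ⋁[_]_
  ⋁[_]_ : Vec Carrier n → Vec Bool n → Carrier
  ⋁[ [] ]     []      = 𝟎
  ⋁[ e ∷ es ] (p ∷ s) = pick p e ∨ ⋁[ es ] s

  ⋁-∨ : (es : Vec Carrier n) (s t : Vec Bool n) →
        ⋁[ es ] s ∨ ⋁[ es ] t ≈ ⋁[ es ] zipWith _∨ᵇ_ s t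
  ⋁-∨ []       []      []      = ∨-idem 𝟎
  ⋁-∨ (e ∷ es) (p ∷ s) (q ∷ t) = begin
    (pick p e ∨ ⋁[ es ] s) ∨ (pick q e ∨ ⋁[ es ] t)
      ≈⟨ ∨-interchange _ _ _ _ ⟩
    (pick p e ∨ pick q e) ∨ (⋁[ es ] s ∨ ⋁[ es ] t)
      ≈⟨ ∨-cong (pick-∨ p q e) (⋁-∨ es s t) ⟩
    pick (p ∨ᵇ q) e ∨ ⋁[ es ] zipWith _∨ᵇ_ s t
      ∎

  ⋁-replicate-false : (es : Vec Carrier n) → ⋁[ es ] replicate n false ≈ 𝟎
  ⋁-replicate-false []       = refl
  ⋁-replicate-false (_ ∷ es) = trans (∨-identityˡ _) (⋁-replicate-false es)

  ⊥-⋁ : {es : Vec Carrier n} → All (u ⊥_) es → (s : Vec Bool n) → u ⊥ ⋁[ es ] s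
  ⊥-⋁ []       []      = ⊥-𝟎 _
  ⊥-⋁ (o ∷ os) (p ∷ s) = ⊥-∨ʳ (⊥-pick p o) (⊥-⋁ os s)

  ⋁-not-⊥ : {es : Vec Carrier n} → AllPairs _⊥_ es →
            (s : Vec Bool n) → ⋁[ es ] map not s ⊥ ⋁[ es ] s
  ⋁-not-⊥ {es = e ∷ _} (os ∷ oss) (p ∷ s) =
    ∨-least (⊥-∨ʳ (pick-not-⊥ p e) (⊥-⋁ (All.map (pick-⊥ (not p)) os) s))
            (⊥-∨ʳ (⊥-sym (⊥-⋁ (All.map (pick-⊥ p) os) (map not s))) (⋁-not-⊥ oss s))
  ⋁-not-⊥ [] [] = 𝟎≤ _

module SpOrthomodularProperties {ℓ₁ ℓ} (A : SpOrthomodularLattice ℓ₁ ℓ) where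
  open SpOrthomodularLattice A
  open PKLNotions pkl
  open PseudoKleeneProperties pkl public
  open import Algebra.Lattice.Properties.Lattice lattice using (∨-idem)
  open import Relation.Binary.Reasoning.Setoid setoid

  private
    variable
      u v w : Carrier

  Sh-orthomodular : Sh u → Sh w → u ≤ w → u ′ ∧ w ≈ 𝟎 → u ≈ w
  Sh-orthomodular {u} {w} hu hw u≤w u′∧w≈𝟎 = begin
    u                ≈⟨ ∨-identityʳ u ⟨
    u ∨ 𝟎            ≈⟨ ∨-congˡ hw ⟨
    u ∨ (w ∧ w ′)    ≈⟨ SP1 u w u≤w (trans u′∧w≈𝟎 (sym 𝟎≈u∧u′∨w∧w′)) ⟨
    w ∧ (u ∨ u ′)    ≈⟨ ∧-congˡ (Sh⇒x∨x′≈𝟏 hu) ⟩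
    w ∧ 𝟏            ≈⟨ ≤𝟏 w ⟩
    w                ∎
    where
    𝟎≈u∧u′∨w∧w′ : (u ∧ u ′) ∨ (w ∧ w ′) ≈ 𝟎
    𝟎≈u∧u′∨w∧w′ = trans (∨-cong hu hw) (∨-idem 𝟎)

  Sh-relativeComplement : Sh u → Sh w → u ≤ w → Sh (u ′ ∧ w)
  Sh-relativeComplement {u} {w} hu hw u≤w =
    trans (sym (SP2 u w u≤w)) (trans (∨-cong hu hw) (∨-idem 𝟎))

  Sh-∨-⊥ : Sh u → Sh v → u ⊥ v → Sh (u ∨ v)
  Sh-∨-⊥ {u} {v} hu hv u⊥v =
    Sh-cong (′-invol (u ∨ v)) (Sh-′ (Sh-cong v′∧u′≈[u∨v]′ h))
    where
    h : Sh (v ′ ∧ u ′)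
    h = Sh-relativeComplement hv (Sh-′ hu) (⊥-sym u⊥v)
    v′∧u′≈[u∨v]′ : v ′ ∧ u ′ ≈ (u ∨ v) ′
    v′∧u′≈[u∨v]′ = trans (∧-comm (v ′) (u ′)) (sym (deMorgan₂ u v))

  Sh-split : Sh u → Sh w → u ≤ w → w ≈ u ∨ (u ′ ∧ w)
  Sh-split {u} {w} hu hw u≤w =
    sym (Sh-orthomodular (Sh-∨-⊥ hu hc (′-flip (x∧y≤x (u ′) w))) hw
                         (∨-least u≤w (x∧y≤y (u ′) w)) [u∨c]′∧w≈𝟎)
    where
    c : Carrier
    c = u ′ ∧ w
    hc : Sh c
    hc = Sh-relativeComplement hu hw u≤w
    [u∨c]′∧w≈𝟎 : (u ∨ c) ′ ∧ w ≈ 𝟎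
    [u∨c]′∧w≈𝟎 = begin
      (u ∨ c) ′ ∧ w      ≈⟨ ∧-congʳ (deMorgan₂ u c) ⟩
      (u ′ ∧ c ′) ∧ w    ≈⟨ ∧-congʳ (∧-comm (u ′) (c ′)) ⟩
      (c ′ ∧ u ′) ∧ w    ≈⟨ ∧-assoc (c ′) (u ′) w ⟩
      c ′ ∧ c            ≈⟨ ∧-comm (c ′) c ⟩
      c ∧ c ′            ≈⟨ hc ⟩
      𝟎                  ∎

  IsSupSh-⊥ : ∀ {s} → Sh u → Sh v → u ⊥ v → IsSupSh u v s → s ≈ u ∨ v
  IsSupSh-⊥ hu hv u⊥v (_ , u≤s , v≤s , least) =
    ≤-antisym (least _ (Sh-∨-⊥ hu hv u⊥v) (x≤x∨y _ _) (y≤x∨y _ _)) (∨-least u≤s v≤s)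

  Sh-⋁ : {es : Vec Carrier n} → All Sh es → AllPairs _⊥_ es →
         (s : Vec Bool n) → Sh (⋁[ es ] s)
  Sh-⋁ []       []         []      = Sh-𝟎
  Sh-⋁ (h ∷ hs) (os ∷ oss) (p ∷ s) =
    Sh-∨-⊥ (Sh-pick p h) (Sh-⋁ hs oss s) (⊥-⋁ (All.map (pick-⊥ p) os) s)

  -- The joins of subfamilies of a sharp partition of unity form a Boolean
  -- subalgebra: ⋁[ es ] preserves ∨ by associativity, ′ by (SP1), and hence
  -- ∧ by De Morgan.
  module SharpPartition {es : Vec Carrier n} (sharp : All Sh es)
    (orthogonal : AllPairs _⊥_ es) (cover : ⋁[ es ] replicate n true ≈ 𝟏) where

    ⋁-′ : (s : Vec Bool n) → (⋁[ es ] s) ′ ≈ ⋁[ es ] map not s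
    ⋁-′ s = sym (Sh-orthomodular (Sh-⋁ sharp orthogonal (map not s))
                                 (Sh-′ (Sh-⋁ sharp orthogonal s))
                                 (⋁-not-⊥ orthogonal s) ⋁s̄′∧⋁s′≈𝟎)
      where
      ⋁s̄′∧⋁s′≈𝟎 : (⋁[ es ] map not s) ′ ∧ (⋁[ es ] s) ′ ≈ 𝟎
      ⋁s̄′∧⋁s′≈𝟎 = begin
        (⋁[ es ] map not s) ′ ∧ (⋁[ es ] s) ′   ≈⟨ deMorgan₂ _ _ ⟨
        (⋁[ es ] map not s ∨ ⋁[ es ] s) ′       ≈⟨ ′-cong (⋁-∨ es (map not s) s) ⟩
        (⋁[ es ] zipWith _∨ᵇ_ (map not s) s) ′  ≡⟨ ≡.cong (λ t → (⋁[ es ] t) ′) (zipWith-∨-inverseˡ s) ⟩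
        (⋁[ es ] replicate n true) ′            ≈⟨ ′-cong cover ⟩
        𝟏 ′                                     ≈⟨ 𝟏′≈𝟎 ⟩
        𝟎                                       ∎

    ⋁-∧ : (s t : Vec Bool n) → ⋁[ es ] s ∧ ⋁[ es ] t ≈ ⋁[ es ] zipWith _∧ᵇ_ s t
    ⋁-∧ s t = begin
      ⋁[ es ] s ∧ ⋁[ es ] t
        ≈⟨ ∧-cong (′-invol _) (′-invol _) ⟨
      (⋁[ es ] s) ′ ′ ∧ (⋁[ es ] t) ′ ′
        ≈⟨ deMorgan₂ _ _ ⟨
      ((⋁[ es ] s) ′ ∨ (⋁[ es ] t) ′) ′
        ≈⟨ ′-cong (∨-cong (⋁-′ s) (⋁-′ t)) ⟩
      (⋁[ es ] map not s ∨ ⋁[ es ] map not t) ′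
        ≈⟨ ′-cong (⋁-∨ es (map not s) (map not t)) ⟩
      (⋁[ es ] zipWith _∨ᵇ_ (map not s) (map not t)) ′
        ≈⟨ ⋁-′ _ ⟩
      ⋁[ es ] map not (zipWith _∨ᵇ_ (map not s) (map not t))
        ≡⟨ ≡.cong ⋁[ es ]_ (map-not-zipWith-∨-not s t) ⟩
      ⋁[ es ] zipWith _∧ᵇ_ s t
        ∎

    ⋁-distrib : (s t r : Vec Bool n) →
      ⋁[ es ] s ∧ (⋁[ es ] t ∨ ⋁[ es ] r) ≈ (⋁[ es ] s ∧ ⋁[ es ] t) ∨ (⋁[ es ] s ∧ ⋁[ es ] r)
    ⋁-distrib s t r = begin
      ⋁[ es ] s ∧ (⋁[ es ] t ∨ ⋁[ es ] r)
        ≈⟨ ∧-congˡ (⋁-∨ es t r) ⟩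
      ⋁[ es ] s ∧ ⋁[ es ] zipWith _∨ᵇ_ t r
        ≈⟨ ⋁-∧ s _ ⟩
      ⋁[ es ] zipWith _∧ᵇ_ s (zipWith _∨ᵇ_ t r)
        ≡⟨ ≡.cong ⋁[ es ]_ (zipWith-∧-distribˡ-∨ s t r) ⟩
      ⋁[ es ] zipWith _∨ᵇ_ (zipWith _∧ᵇ_ s t) (zipWith _∧ᵇ_ s r)
        ≈⟨ ⋁-∨ es _ _ ⟨
      ⋁[ es ] zipWith _∧ᵇ_ s t ∨ ⋁[ es ] zipWith _∧ᵇ_ s r
        ≈⟨ ∨-cong (⋁-∧ s t) (⋁-∧ s r) ⟨
      (⋁[ es ] s ∧ ⋁[ es ] t) ∨ (⋁[ es ] s ∧ ⋁[ es ] r)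
        ∎

    Spanned : Carrier → Set ℓ
    Spanned z = Σ (Vec Bool n) λ s → z ≈ ⋁[ es ] s

    Sg-spanned : ∀ {x y z} → Spanned x → Spanned y → Sg x y z → Spanned z
    Sg-spanned sx sy gen₁ = sx
    Sg-spanned sx sy gen₂ = sy
    Sg-spanned sx sy zer  = replicate n false , sym (⋁-replicate-false es)
    Sg-spanned sx sy one  = replicate n true , sym cover
    Sg-spanned sx sy (join a b) with Sg-spanned sx sy a | Sg-spanned sx sy b
    ... | s , eₛ | t , eₜ = zipWith _∨ᵇ_ s t , trans (∨-cong eₛ eₜ) (⋁-∨ es s t)
    Sg-spanned sx sy (meet a b) with Sg-spanned sx sy a | Sg-spanned sx sy b
    ... | s , eₛ | t , eₜ = zipWith _∧ᵇ_ s t , trans (∧-cong eₛ eₜ) (⋁-∧ s t)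
    Sg-spanned sx sy (inv a) with Sg-spanned sx sy a
    ... | s , eₛ = map not s , trans (′-cong eₛ) (⋁-′ s)

    Sg-booleanSub : ∀ {x y} → Spanned x → Spanned y → BooleanSub (Sg x y)
    Sg-booleanSub sx sy = distrib , sharp-elements
      where
      distrib : Distributive (Sg _ _)
      distrib a b d sa sb sd
        with Sg-spanned sx sy sa | Sg-spanned sx sy sb | Sg-spanned sx sy sd
      ... | s , eₛ | t , eₜ | r , eᵣ =
        trans (∧-cong eₛ (∨-cong eₜ eᵣ))
              (trans (⋁-distrib s t r)
                     (sym (∨-cong (∧-cong eₛ eₜ) (∧-cong eₛ eᵣ))))
      sharp-elements : ∀ z → Sg _ _ z → Sh z
      sharp-elements z sz with Sg-spanned sx sy sz
      ... | s , e = Sh-cong (sym e) (Sh-⋁ sharp orthogonal s)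

  module SplitPartition {y a b : Carrier} (hy : Sh y)
    (ha : Sh a) (a≤y : a ≤ y) (hb : Sh b) (b≤y′ : b ≤ y ′) where

    c d : Carrier
    c = a ′ ∧ y
    d = b ′ ∧ y ′

    c≤y : c ≤ y
    c≤y = x∧y≤y (a ′) y

    d≤y′ : d ≤ y ′
    d≤y′ = x∧y≤y (b ′) (y ′)

    blocks : Vec Carrier 4
    blocks = a ∷ b ∷ c ∷ d ∷ []

    blocks-sharp : All Sh blocks
    blocks-sharp =
      ha ∷ hb ∷ Sh-relativeComplement ha hy a≤y ∷ Sh-relativeComplement hb (Sh-′ hy) b≤y′ ∷ []

    blocks-orthogonal : AllPairs _⊥_ blocks
    blocks-orthogonal =
      (≤-⊥ a≤y b≤y′ ∷ ′-flip (x∧y≤x (a ′) y) ∷ ≤-⊥ a≤y d≤y′ ∷ []) ∷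
      (⊥-sym (≤-⊥ c≤y b≤y′) ∷ ′-flip (x∧y≤x (b ′) (y ′)) ∷ []) ∷
      (≤-⊥ c≤y d≤y′ ∷ []) ∷ [] ∷ []

    a∨b≈⋁ : a ∨ b ≈ ⋁[ blocks ] (true ∷ true ∷ false ∷ false ∷ [])
    a∨b≈⋁ = sym (∨-congˡ (trans (∨-congˡ (trans (∨-identityˡ _) (∨-idem 𝟎))) (∨-identityʳ b)))

    y≈⋁ : y ≈ ⋁[ blocks ] (true ∷ false ∷ true ∷ false ∷ [])
    y≈⋁ = trans (Sh-split ha hy a≤y)
      (sym (∨-congˡ (trans (∨-identityˡ _) (trans (∨-congˡ (∨-idem 𝟎)) (∨-identityʳ c)))))

    y′≈⋁ : y ′ ≈ ⋁[ blocks ] (false ∷ true ∷ false ∷ true ∷ [])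
    y′≈⋁ = trans (Sh-split hb (Sh-′ hy) b≤y′)
      (sym (trans (∨-identityˡ _) (∨-congˡ (trans (∨-identityˡ _) (∨-identityʳ d)))))

    blocks-cover : ⋁[ blocks ] replicate 4 true ≈ 𝟏
    blocks-cover = begin
      ⋁[ blocks ] replicate 4 true                    ≈⟨ ⋁-∨ blocks (true ∷ false ∷ true ∷ false ∷ []) (false ∷ true ∷ false ∷ true ∷ []) ⟨
      ⋁[ blocks ] (true ∷ false ∷ true ∷ false ∷ []) ∨
      ⋁[ blocks ] (false ∷ true ∷ false ∷ true ∷ [])  ≈⟨ ∨-cong y≈⋁ y′≈⋁ ⟨
      y ∨ y ′                                         ≈⟨ Sh⇒x∨x′≈𝟏 hy ⟩
      𝟏                                               ∎

    open SharpPartition blocks-sharp blocks-orthogonal blocks-cover public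

  commute⇒booleanSub : ∀ {x y} → Sh y → Commute x y → BooleanSub (Sg x y)
  commute⇒booleanSub hy (a , b , (ha , _ , a≤y , _) , (hb , _ , b≤y′ , _) , x-sup) =
    Sg-booleanSub
      (true ∷ true ∷ false ∷ false ∷ [] , trans (IsSupSh-⊥ ha hb (≤-⊥ a≤y b≤y′) x-sup) a∨b≈⋁)
      (true ∷ false ∷ true ∷ false ∷ [] , y≈⋁)
    where open SplitPartition hy ha a≤y hb b≤y′

corollary4p6 : ∀ {c ℓ} (A : SpOrthomodularLattice c ℓ) →
    let open SpOrthomodularLattice A
        open PKLNotions pkl
    in ∀ x y → Sh x → Sh y →
       (Distributive (Sg x y) ⇔ Commute x y) × (Commute x y → BooleanSub (Sg x y))
corollary4p6 A x y hx hy =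
  mk⇔ (distributive⇒commute hx hy) (proj₁ ∘ commute⇒booleanSub hy) ,
  commute⇒booleanSub hy
  where open SpOrthomodularProperties A
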